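{- Let $L$ be a complete lattice, $\otimes$ a t-norm and $\oplus$ a t-conorm on $L$, and $\Gamma=\{f_i:L^n\to L: i=1,\dots,n\}$ a distributive family on $\langle L,\oplus,\otimes\rangle$. Then for every $(a_1,\dots,a_n)\in L^n$, $$\bigwedge_{i=1}^n a_i\le DYOWA_\Gamma(a_1,\dots,a_n)\le\bigvee_{i=1}^n a_i.$$
   Context: A complete lattice is a poset in which every subset has a supremum and an infimum; $\bot_L,\top_L$ are its bottom and top. A t-norm on $L$ is an isotonic (monotone in each argument), commutative, associative binary operation $\otimes:L^2\to L$ with neutral element $\top_L$; a t-conorm $\oplus$ is isotonic, commutative, associative with neutral element $\bot_L$. $n$-ary versions: $\bigoplus_{i=1}^n x_i=(\cdots((x_1\oplus x_2)\oplus x_3)\cdots)\oplus x_n$. A family $\Gamma=\{f_1,\dots,f_n\}$ of functions $f_i:L^n\to L$ is a weight function family if $\bigoplus_{i=1}^n f_i(\overrightarrow{a})=\top_L$ for every $\overrightarrow{a}\in L^n$; it is a distributive family if in addition $c\otimes\bigoplus_{i=1}^n f_i(\overrightarrow{a})=\bigoplus_{i=1}^n\big(c\otimes f_i(\overrightarrow{a})\big)$ for all $c\in L$ and $\overrightarrow{a}\in L^n$. The Lizasoain–Moreno function $\mathscr{LM}:L^n\to L^n$ is $\mathscr{LM}(a_1,\dots,a_n)=(b_1,\dots,b_n)$ with $b_k=\bigvee_{\{j_1<\dots<j_k\}\subseteq\{1,\dots,n\}} a_{j_1}\wedge\dots\wedge a_{j_k}$ (join over all $k$-element subsets). $DYOWA_\Gamma(\overrightarrow{a})=\bigoplus_{i=1}^n\big(f_i(\overrightarrow{a})\otimes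 b_i\big)$ where $(b_1,\dots,b_n)=\mathscr{LM}(\overrightarrow{a})$. -}

module Defs where

open import Level using (Level; _⊔_) renaming (suc to lsuc)
open import Data.Nat using (ℕ; zero; suc)
open import Data.Fin using (Fin; zero; suc; toℕ; inject₁; fromℕ)
open import Data.Fin.Subset using (Subset; _∈_; ∣_∣)
open import Data.Product using (Σ; ∃; _×_; _,_)
open import Data.Empty.Polymorphic using (⊥)
open import Relation.Unary using (Pred)
open import Relation.Binary.PropositionalEquality using (_≡_)
open import Relation.Binary.Structures using (IsPartialOrder)
open import Algebra.Core using (Op₂)

record CompleteLattice (c ℓ : Level) : Set (lsuc (c ⊔ ℓ)) where
  infix 4 _≤_
  field
    Carrier        : Set c
    _≤_            : Carrier → Carrier → Set ℓ
    isPartialOrder : IsPartialOrder _≡_ _≤_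
    ⋁              : Pred Carrier c → Carrier
    ⋁-upper        : ∀ (S : Pred Carrier c) x → S x → x ≤ ⋁ S
    ⋁-least        : ∀ (S : Pred Carrier c) y → (∀ x → S x → x ≤ y) → ⋁ S ≤ y
    ⋀              : Pred Carrier c → Carrier
    ⋀-lower        : ∀ (S : Pred Carrier c) x → S x → ⋀ S ≤ x
    ⋀-greatest     : ∀ (S : Pred Carrier c) y → (∀ x → S x → y ≤ x) → y ≤ ⋀ S

  ⊥L : Carrier
  ⊥L = ⋁ (λ _ → ⊥)

  ⊤L : Carrier
  ⊤L = ⋀ (λ _ → ⊥)

module _ {c ℓ : Level} (L : CompleteLattice c ℓ) where
  open CompleteLattice L

  record IsTNorm (_⊗_ : Op₂ Carrier) : Set (c ⊔ ℓ) where
    field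
      isotone  : ∀ {x x′ y y′} → x ≤ x′ → y ≤ y′ → (x ⊗ y) ≤ (x′ ⊗ y′)
      comm     : ∀ x y → (x ⊗ y) ≡ (y ⊗ x)
      assoc    : ∀ x y z → ((x ⊗ y) ⊗ z) ≡ (x ⊗ (y ⊗ z))
      identity : ∀ x → (x ⊗ ⊤L) ≡ x

  record IsTConorm (_⊕_ : Op₂ Carrier) : Set (c ⊔ ℓ) where
    field
      isotone  : ∀ {x x′ y y′} → x ≤ x′ → y ≤ y′ → (x ⊕ y) ≤ (x′ ⊕ y′)
      comm     : ∀ x y → (x ⊕ y) ≡ (y ⊕ x)
      assoc    : ∀ x y z → ((x ⊕ y) ⊕ z) ≡ (x ⊕ (y ⊕ z))
      identity : ∀ x → (x ⊕ ⊥L) ≡ x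

  -- n-ary version (n = suc m ≥ 1), bracketed to the left:
  -- ⨁ x = (⋯((x₁ ⊕ x₂) ⊕ x₃)⋯) ⊕ xₙ
  bigOp : (_⊕_ : Op₂ Carrier) → ∀ {m} → (Fin (suc m) → Carrier) → Carrier
  bigOp _⊕_ {zero}  x = x zero
  bigOp _⊕_ {suc m} x = bigOp _⊕_ {m} (λ i → x (inject₁ i)) ⊕ x (fromℕ (suc m))

  IsWeightFamily : (_⊕_ : Op₂ Carrier) → ∀ {m} →
                   (Fin (suc m) → (Fin (suc m) → Carrier) → Carrier) → Set c
  IsWeightFamily _⊕_ f = ∀ a → bigOp _⊕_ (λ i → f i a) ≡ ⊤L

  record IsDistributiveFamily (_⊕_ _⊗_ : Op₂ Carrier) {m : ℕ}
         (f : Fin (suc m) → (Fin (suc m) → Carrier) → Carrier) : Set c where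
    field
      weight  : IsWeightFamily _⊕_ f
      distrib : ∀ (d : Carrier) a →
                (d ⊗ bigOp _⊕_ (λ i → f i a)) ≡ bigOp _⊕_ (λ i → d ⊗ f i a)

  meetAll : ∀ {n} → (Fin n → Carrier) → Carrier
  meetAll a = ⋀ (λ w → ∃ λ i → w ≡ a i)

  joinAll : ∀ {n} → (Fin n → Carrier) → Carrier
  joinAll a = ⋁ (λ w → ∃ λ i → w ≡ a i)

  -- Lizasoain–Moreno function: b_k = ⋁ over k-element subsets S of ⋀_{j∈S} a_j.
  -- Index i : Fin n corresponds to k = toℕ i + 1.
  LM : ∀ {n} → (Fin n → Carrier) → (Fin n → Carrier)
  LM {n} a i = ⋁ (λ z → Σ (Subset n) λ S →
                 (∣ S ∣ ≡ suc (toℕ i)) × (z ≡ ⋀ (λ w → ∃ λ j → (j ∈ S) × (w ≡ a j))))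

  DYOWA : (_⊕_ _⊗_ : Op₂ Carrier) → ∀ {m} →
          (Fin (suc m) → (Fin (suc m) → Carrier) → Carrier) →
          (Fin (suc m) → Carrier) → Carrier
  DYOWA _⊕_ _⊗_ f a = bigOp _⊕_ (λ i → f i a ⊗ LM a i)

module Submission where

-- Every coordinate bₖ of the Lizasoain–Moreno vector lies between ⋀ᵢ aᵢ and
-- ⋁ᵢ aᵢ: it is a join of meets over k-element subsets, such subsets exist
-- (take the first k indices) and they are non-empty (k ≥ 1).  Independently,
-- a distributive family lets any d be spread over the weights,
--   d = d ⊗ ⊤ = d ⊗ ⨁ᵢ fᵢ(a) = ⨁ᵢ (d ⊗ fᵢ(a)),
-- so by isotonicity of ⊗ and ⊕ the weighted aggregate ⨁ᵢ (fᵢ(a) ⊗ bᵢ) of any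
-- vector b with d ≤ bᵢ ≤ e for all i lies between d and e.  The theorem is
-- this "sandwich" lemma applied to b = LM(a), d = ⋀ᵢ aᵢ, e = ⋁ᵢ aᵢ.

open import Defs
open import Data.Nat using (ℕ; suc)
open import Data.Fin using (Fin; zero; suc; toℕ; inject₁; fromℕ)
open import Data.Product using (_×_; _,_; ∃)
open import Algebra.Core using (Op₂)
open import Data.Fin.Subset using (Subset; _∈_; ∣_∣; inside; Nonempty; ⊥)
open import Data.Fin.Subset.Properties using (∣⊥∣≡0; nonempty?; Empty-unique)
open import Data.Vec using (_∷_)
open import Relation.Nullary using (yes; no; contradiction)
open import Relation.Binary.PropositionalEquality as ≡ using (_≡_; refl; sym; cong)
open import Relation.Binary.Structures using (IsPartialOrder)

-- The subset {0, …, k} of Fin n; it witnesses that subsets of every size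
-- 1 ≤ k + 1 ≤ n exist.
initialSegment : ∀ n → Fin n → Subset n
initialSegment (suc n) zero    = inside ∷ ⊥
initialSegment (suc n) (suc k) = inside ∷ initialSegment n k

initialSegment-size : ∀ n (k : Fin n) → ∣ initialSegment n k ∣ ≡ suc (toℕ k)
initialSegment-size (suc n) zero    = cong suc (∣⊥∣≡0 n)
initialSegment-size (suc n) (suc k) = cong suc (initialSegment-size n k)

-- A subset of positive cardinality has an element: otherwise it is ⊥,
-- whose cardinality is 0.
positive-size⇒nonempty : ∀ {n k} (S : Subset n) → ∣ S ∣ ≡ suc k → Nonempty S
positive-size⇒nonempty {n} S size with nonempty? S
... | yes S≠∅ = S≠∅
... | no  S=∅ = contradiction
  (≡.trans (sym size) (≡.trans (cong ∣_∣ (Empty-unique S=∅)) (∣⊥∣≡0 n))) λ ()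

module _ {c ℓ} (L : CompleteLattice c ℓ) where
  open CompleteLattice L
  open IsPartialOrder isPartialOrder using (trans; reflexive) renaming (refl to ≤-refl)

  meetOn : ∀ {n} → Subset n → (Fin n → Carrier) → Carrier
  meetOn S a = ⋀ (λ w → ∃ λ j → (j ∈ S) × (w ≡ a j))

  meetAll≤meetOn : ∀ {n} (S : Subset n) (a : Fin n → Carrier) → meetAll L a ≤ meetOn S a
  meetAll≤meetOn S a = ⋀-greatest _ _ λ { _ (j , _ , refl) → ⋀-lower _ _ (j , refl) }

  meetOn≤joinAll : ∀ {n} (S : Subset n) (a : Fin n → Carrier) →
                   Nonempty S → meetOn S a ≤ joinAll L a
  meetOn≤joinAll S a (j , j∈S) = trans (⋀-lower _ _ (j , j∈S , refl)) (⋁-upper _ _ (j , refl))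

  meetAll≤LM : ∀ {n} (a : Fin n → Carrier) k → meetAll L a ≤ LM L a k
  meetAll≤LM {n} a k =
    trans (meetAll≤meetOn (initialSegment n k) a)
          (⋁-upper _ _ (initialSegment n k , initialSegment-size n k , refl))

  LM≤joinAll : ∀ {n} (a : Fin n → Carrier) k → LM L a k ≤ joinAll L a
  LM≤joinAll a k =
    ⋁-least _ _ λ { _ (S , size , refl) → meetOn≤joinAll S a (positive-size⇒nonempty S size) }

  module _ (_⊕_ : Op₂ Carrier) (isTConorm : IsTConorm L _⊕_) where
    open IsTConorm isTConorm using () renaming (isotone to ⊕-isotone)

    bigOp-mono : ∀ {m} (x y : Fin (suc m) → Carrier) →
                 (∀ i → x i ≤ y i) → bigOp L _⊕_ x ≤ bigOp L _⊕_ y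
    bigOp-mono {ℕ.zero} x y x≤y = x≤y zero
    bigOp-mono {suc m}  x y x≤y =
      ⊕-isotone (bigOp-mono _ _ (λ i → x≤y (inject₁ i))) (x≤y (fromℕ (suc m)))

    module _ (_⊗_ : Op₂ Carrier) (isTNorm : IsTNorm L _⊗_)
             {m} {f : Fin (suc m) → (Fin (suc m) → Carrier) → Carrier}
             (distributive : IsDistributiveFamily L _⊕_ _⊗_ f)
             (a : Fin (suc m) → Carrier) where
      open IsTNorm isTNorm using ()
        renaming (isotone to ⊗-isotone; comm to ⊗-comm; identity to ⊗-identity)
      open IsDistributiveFamily distributive using (weight; distrib)

      split-along-weights : ∀ d → d ≡ bigOp L _⊕_ (λ i → d ⊗ f i a)
      split-along-weights d = begin
        d                                ≡⟨ sym (⊗-identity d) ⟩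
        d ⊗ ⊤L                           ≡⟨ cong (d ⊗_) (sym (weight a)) ⟩
        d ⊗ bigOp L _⊕_ (λ i → f i a)    ≡⟨ distrib d a ⟩
        bigOp L _⊕_ (λ i → d ⊗ f i a)    ∎
        where open ≡.≡-Reasoning

      weighted-sandwich : ∀ (b : Fin (suc m) → Carrier) {d e} →
        (∀ i → d ≤ b i) → (∀ i → b i ≤ e) →
        (d ≤ bigOp L _⊕_ (λ i → f i a ⊗ b i)) × (bigOp L _⊕_ (λ i → f i a ⊗ b i) ≤ e)
      weighted-sandwich b {d} {e} d≤b b≤e = lower , upper
        where
        lower : d ≤ bigOp L _⊕_ (λ i → f i a ⊗ b i)
        lower = trans (reflexive (split-along-weights d)) (bigOp-mono _ _ λ i →
                  trans (reflexive (⊗-comm d (f i a))) (⊗-isotone ≤-refl (d≤b i)))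
        upper : bigOp L _⊕_ (λ i → f i a ⊗ b i) ≤ e
        upper = trans (bigOp-mono _ _ λ i →
                  trans (⊗-isotone ≤-refl (b≤e i)) (reflexive (⊗-comm (f i a) e)))
                  (reflexive (sym (split-along-weights e)))

proposition4 : ∀ {c ℓ} (L : CompleteLattice c ℓ) →
    let open CompleteLattice L in
    (_⊗_ _⊕_ : Op₂ Carrier) → IsTNorm L _⊗_ → IsTConorm L _⊕_ →
    (m : ℕ) (f : Fin (suc m) → (Fin (suc m) → Carrier) → Carrier) →
    IsDistributiveFamily L _⊕_ _⊗_ f →
    (a : Fin (suc m) → Carrier) →
    (meetAll L a ≤ DYOWA L _⊕_ _⊗_ f a) × (DYOWA L _⊕_ _⊗_ f a ≤ joinAll L a)
proposition4 L _⊗_ _⊕_ isTNorm isTConorm m f distributive a =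
  weighted-sandwich L _⊕_ isTConorm _⊗_ isTNorm distributive a
    (LM L a) (meetAll≤LM L a) (LM≤joinAll L a)
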